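{- Let $\gamma\ge 0$ be an ordinal and $k,r\ge 1$ natural numbers. Then for all $t\ge 0$, $\ell^{F_\gamma}_{r,k}(t)\ge F_{\gamma+k-1}^{\,r}(t)$.
   Context: Fast Growing Hierarchy: $F_0(x)=x+1$, $F_{\alpha+1}(x)=F_\alpha^{x+1}(x)$ (standard Löb–Wainer hierarchy for ordinals; $g^p$ is $p$-fold iteration). The lexicographic ordering on $\mathbb{N}^k$: $x<_{\mathrm{lex}}y$ iff $x[1]<y[1]$, or $x[1]=y[1]$ and $\langle x[2],\dots,x[k]\rangle<_{\mathrm{lex}}\langle y[2],\dots,y[k]\rangle$; $\le_{\mathrm{lex}}$ is its reflexive closure. For a control function $f$, a sequence $x_0,\dots,x_l$ over $\mathbb{N}^k$ is $t$-controlled if $\max_j x_i[j]<f(i+t)$ for all $i$; it is $r$-bad for $\le_{\mathrm{lex}}$ if it contains no indices $i_1<\dots<i_{r+1}$ with $x_{i_1}\le_{\mathrm{lex}}\cdots\le_{\mathrm{lex}}x_{i_{r+1}}$. $\ell^{f}_{r,k}(t)$ denotes the maximal length of a $t$-controlled $r$-bad sequence for $\le_{\mathrm{lex}}$ over $\mathbb{N}^k$ with control function $f$. -}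

module Defs where

open import Data.Nat using (ℕ; zero; suc; _+_; _≤_; _<_)
open import Data.Fin using (Fin; toℕ; _<_)
open import Data.Vec using (Vec; []; _∷_; lookup)
open import Data.Product using (_×_; Σ; ∃)
open import Data.Sum using (_⊎_)
open import Data.Empty using (⊥)
open import Relation.Binary.PropositionalEquality using (_≡_)
open import Relation.Nullary using (¬_)

iter : ℕ → (ℕ → ℕ) → ℕ → ℕ
iter zero    g x = x
iter (suc p) g x = g (iter p g x)

-- Ordinals below ε₀ in Cantor normal form:  ω^ a + b

infixr 5 ω^_+_
data Cnf : Set where
  𝟎     : Cnf
  ω^_+_ : Cnf → Cnf → Cnf

data _<ₒ_ : Cnf → Cnf → Set where
  <𝟎   : ∀ {a b} → 𝟎 <ₒ (ω^ a + b)
  <exp : ∀ {a b c d} → a <ₒ c → (ω^ a + b) <ₒ (ω^ c + d)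
  <rst : ∀ {a b d} → b <ₒ d → (ω^ a + b) <ₒ (ω^ a + d)

data _headBelow_ : Cnf → Cnf → Set where
  hb𝟎 : ∀ {a} → 𝟎 headBelow a
  hb< : ∀ {c d a} → c <ₒ a → (ω^ c + d) headBelow a
  hb≡ : ∀ {a d} → (ω^ a + d) headBelow a

data IsNF : Cnf → Set where
  nf𝟎 : IsNF 𝟎
  nfω : ∀ {a b} → IsNF a → IsNF b → b headBelow a → IsNF (ω^ a + b)

-- Brouwer trees; the standard fundamental sequences are encoded by
-- interpreting CNF terms as trees.

data Brw : Set where
  bz : Brw
  bs : Brw → Brw
  bl : (ℕ → Brw) → Brw

_⊕_ : Brw → Brw → Brw
a ⊕ bz   = a
a ⊕ bs c = bs (a ⊕ c)
a ⊕ bl s = bl (λ x → a ⊕ s x)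

_⊗_ : Brw → ℕ → Brw
a ⊗ zero  = bz
a ⊗ suc n = (a ⊗ n) ⊕ a

-- ω^ b with (γ+ω^{β+1})_x = γ+ω^β·(x+1), (γ+ω^λ)_x = γ+ω^{λ_x}
ωb : Brw → Brw
ωb bz     = bs bz
ωb (bs c) = bl (λ x → ωb c ⊗ suc x)
ωb (bl s) = bl (λ x → ωb (s x))

⟦_⟧ : Cnf → Brw
⟦ 𝟎 ⟧       = bz
⟦ ω^ a + b ⟧ = ωb ⟦ a ⟧ ⊕ ⟦ b ⟧

FB : Brw → ℕ → ℕ
FB bz     x = suc x
FB (bs a) x = iter (suc x) (FB a) x
FB (bl s) x = FB (s x) x

-- F_{γ + n} for γ in CNF and n ∈ ℕ
sucs : ℕ → Brw → Brw
sucs zero    b = b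
sucs (suc n) b = bs (sucs n b)

F : Cnf → ℕ → ℕ → ℕ
F γ n = FB (sucs n ⟦ γ ⟧)

_≤lex_ : ∀ {k} → Vec ℕ k → Vec ℕ k → Set
[]       ≤lex []       = Data.Unit.⊤ where import Data.Unit
(a ∷ x) ≤lex (b ∷ y) = (a Data.Nat.< b) ⊎ ((a ≡ b) × (x ≤lex y))

Seq : ℕ → ℕ → Set
Seq k n = Fin n → Vec ℕ k

Controlled : ∀ {k n} → (ℕ → ℕ) → ℕ → Seq k n → Set
Controlled {k} {n} f t xs = ∀ (i : Fin n) (j : Fin k) → lookup (xs i) j Data.Nat.< f (toℕ i + t)

Bad : ∀ {k n} → ℕ → Seq k n → Set
Bad {k} {n} r xs =
  ¬ (Σ (Fin (suc r) → Fin n) λ ι →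
       (∀ (p : Fin r) → ι (Data.Fin.inject₁ p) Data.Fin.< ι (Data.Fin.suc p)) ×
       (∀ (p : Fin r) → xs (ι (Data.Fin.inject₁ p)) ≤lex xs (ι (Data.Fin.suc p))))

-- ℓ^f_{r,k}(t) ≥ N : there is a t-controlled r-bad sequence of length ≥ N
-- (ℓ is the maximum of such lengths)
ℓ≥ : (f : ℕ → ℕ) (r k t N : ℕ) → Set
ℓ≥ f r k t N = Σ ℕ λ n → (N ≤ n) × Σ (Seq k n) λ xs → Controlled f t xs × Bad r xs

module Submission where

-- Write f = F_γ and G_k = F_{γ+k}, so G_0 = f and G_{k+1}(s) = G_k^{s+1}(s).
-- A *run* at offset s is a finite sequence over ℕ^d whose i-th element is
-- bounded by f(i+s); it is *descending* if no earlier element is ≤lex a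
-- later one (i.e. it is 1-bad).  The construction has three steps:
--   * countdown: f(s)-1, …, 1, 0 is a descending run of length f(s) in ℕ^1;
--   * stacking: n consecutive descending runs, the j-th one starting where
--     the previous one stopped, form a run coloured by n block indices;
--     if each block at offset s has length ≥ h(s), the whole run has
--     length ≥ h^n(s);
--   * raising the dimension: prefixing each element of an (s+1)-coloured
--     run at offset s by s minus its colour makes it descending.
-- By induction on k this yields descending runs in ℕ^{k+1} of length
-- G_k(s); stacking r of them gives an r-coloured run of length G_k^r(t),
-- and an r-coloured run is r-bad since a ≤lex-chain must visit r+1
-- distinct colours.

open import Defs
open import Data.Nat using (ℕ; zero; suc; _+_; _∸_; _≤_; _<_; z≤n; s≤s; s≤s⁻¹; z<s; _≤′_; ≤′-step; ≤′-reflexive; _<?_; _≟_)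
open import Data.Nat.Properties
open import Data.Fin as Fin using (Fin; toℕ; inject₁; fromℕ)
open import Data.Fin.Properties using (toℕ<n; toℕ-fromℕ)
open import Data.Vec using (Vec; []; _∷_; lookup)
open import Data.Product using (Σ; _×_; _,_)
open import Data.Sum using (_⊎_; inj₁; inj₂)
open import Data.Empty using (⊥-elim)
open import Relation.Nullary using (¬_; yes; no)
open import Relation.Binary.Core using (_Preserves_⟶_)
open import Relation.Binary.PropositionalEquality

Monotone : (ℕ → ℕ) → Set
Monotone h = h Preserves _≤_ ⟶ _≤_

iter-cong : ∀ {f g : ℕ → ℕ} → (∀ z → f z ≡ g z) → ∀ n x → iter n f x ≡ iter n g x
iter-cong f≗g zero    x = refl
iter-cong {g = g} f≗g (suc n) x = trans (f≗g _) (cong g (iter-cong f≗g n x))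

iter-peel : ∀ (g : ℕ → ℕ) n x → iter (suc n) g x ≡ iter n g (g x)
iter-peel g zero    x = refl
iter-peel g (suc n) x = cong g (iter-peel g n x)

iter-mono : ∀ {g : ℕ → ℕ} → Monotone g → ∀ n → Monotone (iter n g)
iter-mono g-mono zero    x≤y = x≤y
iter-mono g-mono (suc n) x≤y = g-mono (iter-mono g-mono n x≤y)

iter-inflationary : ∀ {g : ℕ → ℕ} → (∀ z → z ≤ g z) → ∀ n x → x ≤ iter n g x
iter-inflationary g-infl zero    x = ≤-refl
iter-inflationary g-infl (suc n) x = ≤-trans (iter-inflationary g-infl n x) (g-infl _)

iter-count-mono : ∀ {g : ℕ → ℕ} → Monotone g → (∀ z → z ≤ g z) →
  ∀ {m n} → m ≤ n → ∀ x → iter m g x ≤ iter n g x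
iter-count-mono g-mono g-infl {n = n} z≤n x = iter-inflationary g-infl n x
iter-count-mono g-mono g-infl (s≤s m≤n) x = g-mono (iter-count-mono g-mono g-infl m≤n x)

stepwise-monotone : ∀ (h : ℕ → ℕ) → (∀ z → h z ≤ h (suc z)) → Monotone h
stepwise-monotone h step x≤y = go (≤⇒≤′ x≤y)
  where
  go : ∀ {x y} → x ≤′ y → h x ≤ h y
  go (≤′-reflexive refl) = ≤-refl
  go (≤′-step x≤′y)     = ≤-trans (go x≤′y) (step _)

-- bz ⊕ a is not definitionally a, so trees are compared extensionally;
-- FB respects this comparison.

data _≈_ : Brw → Brw → Set where
  ≈z : bz ≈ bz
  ≈s : ∀ {a b} → a ≈ b → bs a ≈ bs b
  ≈l : ∀ {s t} → (∀ x → s x ≈ t x) → bl s ≈ bl t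

≈-refl : ∀ a → a ≈ a
≈-refl bz     = ≈z
≈-refl (bs a) = ≈s (≈-refl a)
≈-refl (bl s) = ≈l (λ x → ≈-refl (s x))

⊕-cong : ∀ {a a′ b b′} → a ≈ a′ → b ≈ b′ → (a ⊕ b) ≈ (a′ ⊕ b′)
⊕-cong a≈a′ ≈z       = a≈a′
⊕-cong a≈a′ (≈s b≈b′) = ≈s (⊕-cong a≈a′ b≈b′)
⊕-cong a≈a′ (≈l s≈t) = ≈l (λ x → ⊕-cong a≈a′ (s≈t x))

⊗-cong : ∀ {a a′} → a ≈ a′ → ∀ n → (a ⊗ n) ≈ (a′ ⊗ n)
⊗-cong a≈a′ zero    = ≈z
⊗-cong a≈a′ (suc n) = ⊕-cong (⊗-cong a≈a′ n) a≈a′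

ωb-cong : ∀ {a a′} → a ≈ a′ → ωb a ≈ ωb a′
ωb-cong ≈z        = ≈s ≈z
ωb-cong (≈s a≈a′) = ≈l (λ x → ⊗-cong (ωb-cong a≈a′) (suc x))
ωb-cong (≈l s≈t)  = ≈l (λ x → ωb-cong (s≈t x))

bz⊕-identity : ∀ a → (bz ⊕ a) ≈ a
bz⊕-identity bz     = ≈z
bz⊕-identity (bs a) = ≈s (bz⊕-identity a)
bz⊕-identity (bl s) = ≈l (λ x → bz⊕-identity (s x))

FB-cong : ∀ {a b} → a ≈ b → ∀ x → FB a x ≡ FB b x
FB-cong ≈z       x = refl
FB-cong (≈s a≈b) x = iter-cong (FB-cong a≈b) (suc x) x
FB-cong (≈l s≈t) x = FB-cong (s≈t x) x

data _↠⟨_⟩_ : Brw → ℕ → Brw → Set where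
  ↠≈     : ∀ {a b y} → a ≈ b → a ↠⟨ y ⟩ b
  ↠bs    : ∀ {a y} → bs a ↠⟨ y ⟩ a
  ↠bl    : ∀ {s y} → bl s ↠⟨ y ⟩ s y
  ↠trans : ∀ {a b c y} → a ↠⟨ y ⟩ b → b ↠⟨ y ⟩ c → a ↠⟨ y ⟩ c

↠-⊕ : ∀ {y b c} a → b ↠⟨ y ⟩ c → (a ⊕ b) ↠⟨ y ⟩ (a ⊕ c)
↠-⊕ a (↠≈ b≈c)       = ↠≈ (⊕-cong (≈-refl a) b≈c)
↠-⊕ a ↠bs            = ↠bs
↠-⊕ a ↠bl            = ↠bl
↠-⊕ a (↠trans b↠ ↠c) = ↠trans (↠-⊕ a b↠) (↠-⊕ a ↠c)

↠-bz : ∀ y a → a ↠⟨ y ⟩ bz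
↠-bz y bz     = ↠≈ ≈z
↠-bz y (bs a) = ↠trans ↠bs (↠-bz y a)
↠-bz y (bl s) = ↠trans ↠bl (↠-bz y (s y))

↠-⊗-pred : ∀ y a n → (a ⊗ suc n) ↠⟨ y ⟩ (a ⊗ n)
↠-⊗-pred y a n = ↠-⊕ (a ⊗ n) (↠-bz y a)

↠-⊗-base : ∀ y a n → (a ⊗ suc n) ↠⟨ y ⟩ a
↠-⊗-base y a zero    = ↠≈ (bz⊕-identity a)
↠-⊗-base y a (suc n) = ↠trans (↠-⊗-pred y a (suc n)) (↠-⊗-base y a n)

-- ω^b descends to ω^c whenever b does; the key case ω^{a+1} ↠ ω^a
-- passes through ω^a·(y+1).
↠-ωb : ∀ {y b c} → b ↠⟨ y ⟩ c → ωb b ↠⟨ y ⟩ ωb c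
↠-ωb (↠≈ b≈c)           = ↠≈ (ωb-cong b≈c)
↠-ωb {y} (↠bs {a})      = ↠trans ↠bl (↠-⊗-base y (ωb a) y)
↠-ωb ↠bl                = ↠bl
↠-ωb (↠trans b↠ ↠c)     = ↠trans (↠-ωb b↠) (↠-ωb ↠c)

FB-inflationary : ∀ a x → x < FB a x
FB-inflationary bz     x = ≤-refl
FB-inflationary (bs a) x =
  ≤-<-trans (iter-inflationary (λ z → <⇒≤ (FB-inflationary a z)) x x) (FB-inflationary a _)
FB-inflationary (bl s) x = FB-inflationary (s x) x

↠-FB : ∀ {y a b} → a ↠⟨ y ⟩ b → FB b y ≤ FB a y
↠-FB {y} (↠≈ a≈b)     = ≤-reflexive (sym (FB-cong a≈b y))
↠-FB {y} (↠bs {a})    =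
  subst (FB a y ≤_) (sym (iter-peel (FB a) y y))
        (iter-inflationary (λ z → <⇒≤ (FB-inflationary a z)) y (FB a y))
↠-FB ↠bl              = ≤-refl
↠-FB (↠trans a↠ ↠b)   = ≤-trans (↠-FB ↠b) (↠-FB a↠)

-- Bachmann trees: every limit's fundamental sequence satisfies
-- s(x+1) ↠⟨ x+1 ⟩ s(x).  This is exactly what makes FB monotone, and it
-- holds for all trees denoting CNF terms.

data Bachmann : Brw → Set where
  bach-z : Bachmann bz
  bach-s : ∀ {a} → Bachmann a → Bachmann (bs a)
  bach-l : ∀ {s} → (∀ x → Bachmann (s x)) →
           (∀ x → s (suc x) ↠⟨ suc x ⟩ s x) → Bachmann (bl s)

Bachmann-⊕ : ∀ {a b} → Bachmann a → Bachmann b → Bachmann (a ⊕ b)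
Bachmann-⊕ ba bach-z          = ba
Bachmann-⊕ ba (bach-s bb)     = bach-s (Bachmann-⊕ ba bb)
Bachmann-⊕ {a} ba (bach-l bs↓ desc) =
  bach-l (λ x → Bachmann-⊕ ba (bs↓ x)) (λ x → ↠-⊕ a (desc x))

Bachmann-⊗ : ∀ {a} → Bachmann a → ∀ n → Bachmann (a ⊗ n)
Bachmann-⊗ ba zero    = bach-z
Bachmann-⊗ ba (suc n) = Bachmann-⊕ (Bachmann-⊗ ba n) ba

Bachmann-ωb : ∀ {b} → Bachmann b → Bachmann (ωb b)
Bachmann-ωb bach-z               = bach-s bach-z
Bachmann-ωb (bach-s {c} bc)      =
  bach-l (λ x → Bachmann-⊗ (Bachmann-ωb bc) (suc x))
         (λ x → ↠-⊗-pred (suc x) (ωb c) (suc x))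
Bachmann-ωb (bach-l bs↓ desc)    =
  bach-l (λ x → Bachmann-ωb (bs↓ x)) (λ x → ↠-ωb (desc x))

Bachmann-⟦⟧ : ∀ γ → Bachmann ⟦ γ ⟧
Bachmann-⟦⟧ 𝟎          = bach-z
Bachmann-⟦⟧ (ω^ a + b) = Bachmann-⊕ (Bachmann-ωb (Bachmann-⟦⟧ a)) (Bachmann-⟦⟧ b)

Bachmann-sucs : ∀ {b} → Bachmann b → ∀ n → Bachmann (sucs n b)
Bachmann-sucs bb zero    = bb
Bachmann-sucs bb (suc n) = bach-s (Bachmann-sucs bb n)

-- F_α is monotone for Bachmann trees; at a limit, F_{s(x)}(x) increases
-- with x because s(x+1) descends to s(x) at x+1.
FB-mono : ∀ {a} → Bachmann a → Monotone (FB a)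
FB-mono bach-z x≤y = s≤s x≤y
FB-mono (bach-s {a} ba) {x} {y} x≤y =
  ≤-trans (iter-mono (FB-mono ba) (suc x) x≤y)
          (iter-count-mono (FB-mono ba) (λ z → <⇒≤ (FB-inflationary a z)) (s≤s x≤y) y)
FB-mono (bach-l {s} bs↓ desc) =
  stepwise-monotone (λ z → FB (s z) z)
    (λ z → ≤-trans (FB-mono (bs↓ z) (n≤1+n z)) (↠-FB (desc z)))

cons-≰lex : ∀ {d a b} {u v : Vec ℕ d} →
  b < a ⊎ (a ≡ b × ¬ u ≤lex v) → ¬ ((a ∷ u) ≤lex (b ∷ v))
cons-≰lex (inj₁ b<a)         (inj₁ a<b)         = <-asym a<b b<a
cons-≰lex (inj₁ b<a)         (inj₂ (refl , _))  = <-irrefl refl b<a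
cons-≰lex (inj₂ (a≡b , _))   (inj₁ a<b)         = <-irrefl a≡b a<b
cons-≰lex (inj₂ (_ , u≰v))   (inj₂ (_ , u≤v))   = u≰v u≤v

-- Runs: finite sequences over ℕ^d, given as functions on ℕ of which only
-- the first len values matter, whose i-th element is bounded by f(i+s).

record Run (f : ℕ → ℕ) (d s : ℕ) : Set where
  field
    len        : ℕ
    elem       : ℕ → Vec ℕ d
    controlled : ∀ i → i < len → ∀ j → lookup (elem i) j < f (i + s)
open Run

module _ {f : ℕ → ℕ} {d s : ℕ} where

  Descending : Run f d s → Set
  Descending ρ = ∀ i j → i < j → j < len ρ → ¬ (elem ρ i ≤lex elem ρ j)

  -- A partition of the run into n consecutive descending blocks,
  -- indexed by their colour.
  record Colouring (ρ : Run f d s) (n : ℕ) : Set where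
    field
      colour      : ℕ → ℕ
      monotone    : Monotone colour
      bounded     : ∀ i → i < len ρ → colour i < n
      descending  : ∀ i j → i < j → j < len ρ → colour i ≡ colour j →
                    ¬ (elem ρ i ≤lex elem ρ j)

Block : (f : ℕ → ℕ) (d s N : ℕ) → Set
Block f d s N = Σ (Run f d s) λ ρ → N ≤ len ρ × Descending ρ

Stack : (f : ℕ → ℕ) (d s n N : ℕ) → Set
Stack f d s n N = Σ (Run f d s) λ ρ → N ≤ len ρ × Colouring ρ n

-- Concatenation of runs: the second run continues at the offset where
-- the first one stops, so the control bound carries over.

splice : {A : Set} → ℕ → (ℕ → A) → (ℕ → A) → ℕ → A
splice L g h i with i <? L
... | yes _ = g i
... | no  _ = h (i ∸ L)

shifted-index : ∀ {i L M} → i < L + M → L ≤ i → i ∸ L < M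
shifted-index {i} {L} {M} i<L+M L≤i = subst (i ∸ L <_) (m+n∸m≡n L M) (∸-monoˡ-< i<L+M L≤i)

shifted-offset : ∀ i L s → L ≤ i → i ∸ L + (s + L) ≡ i + s
shifted-offset i L s L≤i = begin
  i ∸ L + (s + L) ≡⟨ cong (i ∸ L +_) (+-comm s L) ⟩
  i ∸ L + (L + s) ≡⟨ sym (+-assoc (i ∸ L) L s) ⟩
  i ∸ L + L + s   ≡⟨ cong (_+ s) (m∸n+n≡m L≤i) ⟩
  i + s           ∎
  where open ≡-Reasoning

module _ {f : ℕ → ℕ} {d s : ℕ} where

  _++ᴿ_ : (ρ : Run f d s) → Run f d (s + len ρ) → Run f d s
  ρ ++ᴿ σ = record
    { len        = len ρ + len σ
    ; elem       = splice (len ρ) (elem ρ) (elem σ)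
    ; controlled = bound
    }
    where
    bound : ∀ i → i < len ρ + len σ → ∀ j →
            lookup (splice (len ρ) (elem ρ) (elem σ) i) j < f (i + s)
    bound i i<len j with i <? len ρ
    ... | yes i<L = controlled ρ i i<L j
    ... | no  i≮L = subst (λ z → lookup (elem σ (i ∸ len ρ)) j < f z)
                          (shifted-offset i (len ρ) s (≮⇒≥ i≮L))
                          (controlled σ (i ∸ len ρ) (shifted-index i<len (≮⇒≥ i≮L)) j)

  single-colouring : {ρ : Run f d s} → Descending ρ → Colouring ρ 1
  single-colouring desc = record
    { colour     = λ _ → 0
    ; monotone   = λ _ → z≤n
    ; bounded    = λ _ _ → z<s
    ; descending = λ i j i<j j<L _ → desc i j i<j j<L
    }

  prepend-block : {ρ : Run f d s} {σ : Run f d (s + len ρ)} {n : ℕ} →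
    Descending ρ → Colouring σ n → Colouring (ρ ++ᴿ σ) (suc n)
  prepend-block {ρ} {σ} {n} desc col = record
    { colour     = c
    ; monotone   = mono
    ; bounded    = bnd
    ; descending = dsc
    }
    where
    open Colouring col renaming (colour to c′; monotone to mono′; bounded to bnd′; descending to dsc′)
    L = len ρ
    c : ℕ → ℕ
    c = splice L (λ _ → 0) (λ i → suc (c′ i))

    mono : Monotone c
    mono {i} {j} i≤j with i <? L | j <? L
    ... | yes _   | _      = z≤n
    ... | no  i≮L | yes j<L = ⊥-elim (i≮L (≤-<-trans i≤j j<L))
    ... | no  _   | no  _   = s≤s (mono′ (∸-monoˡ-≤ L i≤j))

    bnd : ∀ i → i < L + len σ → c i < suc n
    bnd i i<len with i <? L
    ... | yes _   = z<s
    ... | no  i≮L = s≤s (bnd′ (i ∸ L) (shifted-index i<len (≮⇒≥ i≮L)))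

    dsc : ∀ i j → i < j → j < L + len σ → c i ≡ c j →
          ¬ (elem (ρ ++ᴿ σ) i ≤lex elem (ρ ++ᴿ σ) j)
    dsc i j i<j j<len with i <? L | j <? L
    ... | yes _   | yes j<L = λ _ → desc i j i<j j<L
    ... | yes _   | no  _   = λ ()
    ... | no  i≮L | yes j<L = ⊥-elim (i≮L (<-trans i<j j<L))
    ... | no  i≮L | no  j≮L = λ same → dsc′ (i ∸ L) (j ∸ L) (∸-monoˡ-< i<j (≮⇒≥ i≮L))
                                          (shifted-index j<len (≮⇒≥ j≮L)) (suc-injective same)

module _ {f : ℕ → ℕ} where

  countdown : Monotone f → ∀ s → Block f 1 s (f s)
  countdown f-mono s = ρ , ≤-refl , desc
    where
    value : ℕ → ℕ
    value i = f s ∸ suc i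

    bound : ∀ i → i < f s → ∀ j → lookup (value i ∷ []) j < f (i + s)
    bound i i<fs Fin.zero = <-≤-trans (∸-monoʳ-< z<s i<fs) (f-mono (m≤n+m s i))

    ρ : Run f 1 s
    ρ = record { len = f s ; elem = λ i → value i ∷ [] ; controlled = bound }

    desc : Descending ρ
    desc i j i<j j<fs = cons-≰lex (inj₁ (∸-monoʳ-< (s≤s i<j) j<fs))

  stack : ∀ {d} (h : ℕ → ℕ) → Monotone h → (∀ s → Block f d s (h s)) →
    ∀ n s → Stack f d s (suc n) (iter (suc n) h s)
  stack h h-mono block zero s with block s
  ... | ρ , long , desc = ρ , long , single-colouring desc
  stack h h-mono block (suc n) s with block s
  ... | ρ , long₁ , desc with stack h h-mono block n (s + len ρ)
  ... | σ , long₂ , col = ρ ++ᴿ σ , long , prepend-block desc col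
    where
    open ≤-Reasoning
    long : iter (suc (suc n)) h s ≤ len ρ + len σ
    long = begin
      iter (suc (suc n)) h s     ≡⟨ iter-peel h (suc n) s ⟩
      iter (suc n) h (h s)       ≤⟨ iter-mono h-mono (suc n) (≤-trans long₁ (m≤n+m (len ρ) s)) ⟩
      iter (suc n) h (s + len ρ) ≤⟨ long₂ ⟩
      len σ                      ≤⟨ m≤n+m (len σ) (len ρ) ⟩
      len ρ + len σ              ∎

  -- Prefixing the i-th element of an (s+1)-coloured run at offset s by
  -- s − colour(i) makes it descending: across blocks the new heads
  -- strictly decrease, inside a block the old elements already do.
  raise-dimension : ∀ {d s N} → (∀ x → x < f x) → Stack f d s (suc s) N → Block f (suc d) s N
  raise-dimension {d} {s} f-infl (ρ , long , col) = ρ′ , long , desc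
    where
    open Colouring col
    prefixed : ℕ → Vec ℕ (suc d)
    prefixed i = (s ∸ colour i) ∷ elem ρ i

    bound : ∀ i → i < len ρ → ∀ j → lookup (prefixed i) j < f (i + s)
    bound i _    Fin.zero    =
      ≤-<-trans (≤-trans (m∸n≤m s (colour i)) (m≤n+m s i)) (f-infl (i + s))
    bound i i<L (Fin.suc j) = controlled ρ i i<L j

    ρ′ : Run f (suc d) s
    ρ′ = record { len = len ρ ; elem = prefixed ; controlled = bound }

    desc : Descending ρ′
    desc i j i<j j<L with colour i ≟ colour j
    ... | yes same = cons-≰lex (inj₂ (cong (s ∸_) same , descending i j i<j j<L same))
    ... | no  diff = cons-≰lex (inj₁ (∸-monoʳ-< (≤∧≢⇒< (monotone (<⇒≤ i<j)) diff)
                                                 (s≤s⁻¹ (bounded j j<L))))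

increasing-≥-index : ∀ n (h : Fin (suc n) → ℕ) → (∀ p → h (inject₁ p) < h (Fin.suc p)) →
  ∀ p → toℕ p ≤ h p
increasing-≥-index n       h incr Fin.zero    = z≤n
increasing-≥-index (suc n) h incr (Fin.suc p) =
  ≤-trans (s≤s (increasing-≥-index n (λ q → h (inject₁ q)) (λ q → incr (inject₁ q)) p)) (incr p)

module _ {f : ℕ → ℕ} {d s : ℕ} where

  toSeq : (ρ : Run f d s) → Seq d (len ρ)
  toSeq ρ i = elem ρ (toℕ i)

  toSeq-controlled : (ρ : Run f d s) → Controlled f s (toSeq ρ)
  toSeq-controlled ρ i = controlled ρ (toℕ i) (toℕ<n i)

  -- Along a ≤lex-chain the colours strictly increase, so a chain of
  -- length n+1 would need a colour ≥ n.
  colouring⇒bad : ∀ {n} (ρ : Run f d s) → Colouring ρ n → Bad n (toSeq ρ)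
  colouring⇒bad {n} ρ col (ι , increasing , chain) =
    <⇒≱ (bounded (toℕ last) (toℕ<n last))
        (subst (_≤ colour (toℕ last)) (toℕ-fromℕ n)
               (increasing-≥-index n (λ p → colour (toℕ (ι p))) colour-increases (fromℕ n)))
    where
    open Colouring col
    last : Fin (len ρ)
    last = ι (fromℕ n)
    colour-increases : ∀ p → colour (toℕ (ι (inject₁ p))) < colour (toℕ (ι (Fin.suc p)))
    colour-increases p =
      ≤∧≢⇒< (monotone (<⇒≤ (increasing p)))
            (λ same → descending _ _ (increasing p) (toℕ<n (ι (Fin.suc p))) same (chain p))

descending-run : ∀ {b} → Bachmann b → ∀ k s → Block (FB b) (suc k) s (FB (sucs k b) s)
descending-run bb zero    s = countdown (FB-mono bb) s
descending-run {b} bb (suc k) s =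
  raise-dimension (FB-inflationary b)
    (stack (FB (sucs k b)) (FB-mono (Bachmann-sucs bb k)) (descending-run bb k) s s)

-- Proposition 2: stacking r descending runs of length F_{γ+k-1} yields a
-- t-controlled r-bad sequence of length ≥ F_{γ+k-1}^r(t).
proposition2 : (γ : Cnf) → IsNF γ → (k r : ℕ) → 1 ≤ k → 1 ≤ r → (t : ℕ) →
    ℓ≥ (F γ 0) r k t (iter r (F γ (k ∸ 1)) t)
proposition2 γ _ (suc k) (suc r) _ _ t =
  let bγ               = Bachmann-⟦⟧ γ
      (ρ , long , col) = stack (F γ k) (FB-mono (Bachmann-sucs bγ k)) (descending-run bγ k) r t
  in  len ρ , long , toSeq ρ , toSeq-controlled ρ , colouring⇒bad ρ col
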